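{- Let $\Gamma$ be an AGW graph in which some vertex has two incoming bunches, i.e. there are two distinct vertices $\mathbf q,\mathbf r$ such that all outgoing edges of $\mathbf q$ and all outgoing edges of $\mathbf r$ end at the same vertex $\mathbf p$. Then every coloring of $\Gamma$ yields an automaton having a stable pair of states.
   Context: An AGW graph is a finite directed strongly connected graph (multiple edges allowed) in which all vertices have the same outdegree $k$, and the greatest common divisor of the lengths of all its cycles is $1$. The set of all outgoing edges of a vertex is called a bunch if all these edges end at a single vertex. A coloring assigns to the edges letters from an alphabet $\Sigma$ with $|\Sigma|=k$ so that the outgoing edges of each vertex receive distinct letters, giving a deterministic complete automaton on the vertex set; $\mathbf p s$ denotes the end of the path from $\mathbf p$ labeled by the word $s\in\Sigma^+$. A pair of distinct states $\mathbf p,\mathbf q$ is synchronizing if $\mathbf p s=\mathbf q s$ for some $s\in\Sigma^+$. A synchronizing pair $\mathbf p,\mathbf q$ is stable if for every word $u$ the pair $\mathbf p u,\mathbf q u$ is also synchronizing (or equal). -}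

module Defs where

open import Data.Nat using (ℕ; zero; suc; _+_)
open import Data.Nat.Divisibility using (_∣_)
open import Data.Fin using (Fin)
open import Data.List using (List; []; _∷_; length)
open import Data.Product using (Σ; ∃; _×_; _,_)
open import Data.Sum using (_⊎_)
open import Relation.Binary.PropositionalEquality using (_≡_; _≢_)
open import Function.Bundles using (_↔_; Inverse)

-- A finite directed graph with vertex set Fin n in which every vertex has
-- outdegree k: the outgoing edges of vertex v are indexed by Fin k, and
-- edge i of v ends at (target v i).  Multiple edges are allowed.
record OutRegularGraph (n k : ℕ) : Set where
  field
    target : Fin n → Fin k → Fin n
open OutRegularGraph public

module _ {n k : ℕ} (G : OutRegularGraph n k) where

  data Walk : Fin n → Fin n → Set where
    [] : ∀ {v} → Walk v v
    step : ∀ {u w} (i : Fin k) → Walk (target G u i) w → Walk u w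

  walkLength : ∀ {u v} → Walk u v → ℕ
  walkLength [] = zero
  walkLength (step _ w) = suc (walkLength w)

  StronglyConnected : Set
  StronglyConnected = ∀ (u v : Fin n) → Walk u v

  IsCycleLength : ℕ → Set
  IsCycleLength m = Σ (Fin n) λ v → Σ (Walk v v) λ c → (walkLength c ≡ m) × (m ≢ zero)

  -- gcd of the lengths of all cycles is 1: every common divisor is 1
  CycleGcdOne : Set
  CycleGcdOne = ∀ (d : ℕ) → (∀ m → IsCycleLength m → d ∣ m) → d ≡ 1

  BunchTo : Fin n → Fin n → Set
  BunchTo q p = ∀ (i : Fin k) → target G q i ≡ p

record AGW (n k : ℕ) (G : OutRegularGraph n k) : Set where
  field
    strongly-connected : StronglyConnected G
    aperiodic          : CycleGcdOne G

-- A coloring with alphabet Σ = Fin k: for every vertex, a bijection between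
-- its outgoing edges and the letters (so outgoing edges get distinct letters).
Coloring : (n k : ℕ) → Set
Coloring n k = Fin n → (Fin k ↔ Fin k)

module _ {n k : ℕ} (G : OutRegularGraph n k) (col : Coloring n k) where

  δ : Fin n → Fin k → Fin n
  δ p a = target G p (Inverse.from (col p) a)

  run : Fin n → List (Fin k) → Fin n
  run p [] = p
  run p (a ∷ s) = run (δ p a) s

  SynchronizingPair : Fin n → Fin n → Set
  SynchronizingPair p q =
    (p ≢ q) × Σ (List (Fin k)) λ s → (length s ≢ zero) × (run p s ≡ run q s)

  StablePair : Fin n → Fin n → Set
  StablePair p q =
    SynchronizingPair p q ×
    (∀ (u : List (Fin k)) → (run p u ≡ run q u) ⊎ SynchronizingPair (run p u) (run q u))

  HasStablePair : Set
  HasStablePair = Σ (Fin n) λ p → Σ (Fin n) λ q → StablePair p q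

module Submission where

-- If all outgoing edges of q and of r end at the same vertex p,
-- then under ANY coloring every letter sends both q and r to p.  Hence the
-- distinct states q, r merge after every nonempty word, and for the empty
-- word they are the synchronizing pair q, r itself: q, r is a stable pair.
-- The only thing to supply is a letter witnessing that the merging word can
-- be nonempty, i.e. that the alphabet is inhabited; this follows from strong
-- connectivity, since a walk between the distinct vertices q and r must
-- start with some edge.

open import Defs
open import Data.Nat using (ℕ)
open import Data.Fin using (Fin)
open import Data.List using (List; []; _∷_)
open import Data.Product using (_,_)
open import Data.Sum using (_⊎_; inj₁; inj₂)
open import Data.Empty using (⊥-elim)
open import Relation.Binary.PropositionalEquality
  using (_≡_; _≢_; refl; trans; sym; cong)

first-edge : ∀ {n k} (G : OutRegularGraph n k) {u v : Fin n} →
  u ≢ v → Walk G u v → Fin k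
first-edge G u≢v []         = ⊥-elim (u≢v refl)
first-edge G u≢v (step i _) = i

module _ {n k : ℕ} (G : OutRegularGraph n k) (col : Coloring n k) where

  AgreeOnLetters : Fin n → Fin n → Set
  AgreeOnLetters q r = ∀ (a : Fin k) → δ G col q a ≡ δ G col r a

  -- Whatever the coloring, a letter follows some outgoing edge, and a bunch
  -- sends every outgoing edge to the same vertex.
  bunch-δ : ∀ {q p} → BunchTo G q p → ∀ (a : Fin k) → δ G col q a ≡ p
  bunch-δ bunch a = bunch _

  bunches-agree : ∀ {p q r} → BunchTo G q p → BunchTo G r p → AgreeOnLetters q r
  bunches-agree bq br a = trans (bunch-δ bq a) (sym (bunch-δ br a))

  agree-run : ∀ {q r} → AgreeOnLetters q r →
    ∀ (a : Fin k) (s : List (Fin k)) → run G col q (a ∷ s) ≡ run G col r (a ∷ s)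
  agree-run agree a s = cong (λ x → run G col x s) (agree a)

  agree-stable : ∀ {q r} → Fin k → q ≢ r → AgreeOnLetters q r → StablePair G col q r
  agree-stable {q} {r} a₀ q≢r agree = synchronizing , stable
    where
    synchronizing : SynchronizingPair G col q r
    synchronizing = q≢r , a₀ ∷ [] , (λ ()) , agree a₀

    stable : ∀ (u : List (Fin k)) →
      (run G col q u ≡ run G col r u) ⊎ SynchronizingPair G col (run G col q u) (run G col r u)
    stable []      = inj₂ synchronizing
    stable (a ∷ s) = inj₁ (agree-run agree a s)

lemma4 : (n k : ℕ) (G : OutRegularGraph n k) → AGW n k G →
    (p q r : Fin n) → q ≢ r → BunchTo G q p → BunchTo G r p →
    (col : Coloring n k) → HasStablePair G col
lemma4 n k G agw p q r q≢r bq br col =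
  q , r , agree-stable G col letter q≢r (bunches-agree G col bq br)
  where
  letter : Fin k
  letter = first-edge G q≢r (AGW.strongly-connected agw q r)
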